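{- Let $\mathbb{P}=(R,G')$ be a skew partial field such that the ternary Reid geometry $R_9$ is representable over $\mathbb{P}$. Then $R$ contains $\mathrm{GF}(3)$ as a subring.
   Context: A skew partial field is a pair $(R,G')$ with $R$ a (not necessarily commutative) ring with identity and $G'$ a subgroup of the units $R^*$ with $-1\in G'$. An $R$-chain group on a finite set $E$ is a subset of $R^E$ containing $0$ and closed under componentwise addition and left scalar multiplication. A chain $c$ is elementary in $C$ if $c\ne0$ and no nonzero chain of $C$ has support strictly contained in $\|c\|=\{e:c_e\ne0\}$; $c$ is $G'$-primitive if its entries lie in $G'\cup\{0\}$. A $(R,G')$-chain group is an $R$-chain group in which every elementary chain equals $rc'$ with $r\in R$, $c'$ a $G'$-primitive chain of the group; $M(C)$ is the matroid whose cocircuits are supports of elementary chains. A matroid $M$ is representable over $(R,G')$ if $M=M(C)$ for such a chain group $C$. The ternary Reid geometry $R_9$ is the matroid on $\{1,\dots,9\}$ represented over $\mathrm{GF}(3)$ (column matroid) by the matrix with columns $1,\dots,9$: $$\begin{bmatrix}1&0&0&1&1&1&0&0&1\\0&1&0&1&1&2&1&1&0\\0&0&1&1&0&0&1&2&1\end{bmatrix}.$$ -}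

module Defs where

open import Level using (Level; _⊔_) renaming (suc to lsuc)
open import Algebra.Bundles using (Ring)
open import Algebra.Bundles.Raw using (RawRing)
open import Algebra.Morphism.Structures using (IsRingMonomorphism)
open import Data.Fin using (Fin; zero; suc)
open import Data.Bool using (Bool; true)
open import Data.Product using (Σ; ∃; _×_; _,_)
open import Data.Sum using (_⊎_)
open import Relation.Nullary using (¬_)
open import Relation.Unary using (Pred; _⊆_)
open import Relation.Binary.PropositionalEquality using (_≡_)
open import Function.Bundles using (_⇔_)

GF3 : Set
GF3 = Fin 3

_+₃_ : GF3 → GF3 → GF3
zero +₃ y = y
x +₃ zero = x
suc zero +₃ suc zero = suc (suc zero)
suc zero +₃ suc (suc zero) = zero
suc (suc zero) +₃ suc zero = zero
suc (suc zero) +₃ suc (suc zero) = suc zero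

_*₃_ : GF3 → GF3 → GF3
zero *₃ y = zero
suc zero *₃ y = y
suc (suc zero) *₃ zero = zero
suc (suc zero) *₃ suc zero = suc (suc zero)
suc (suc zero) *₃ suc (suc zero) = suc zero

-₃_ : GF3 → GF3
-₃ zero = zero
-₃ suc zero = suc (suc zero)
-₃ suc (suc zero) = suc zero

GF3-rawRing : RawRing Level.zero Level.zero
GF3-rawRing = record
  { Carrier = GF3 ; _≈_ = _≡_ ; _+_ = _+₃_ ; _*_ = _*₃_
  ; -_ = -₃_ ; 0# = zero ; 1# = suc zero }

ContainsGF3 : ∀ {c ℓ} → Ring c ℓ → Set (c ⊔ ℓ)
ContainsGF3 R = Σ (GF3 → Ring.Carrier R) λ f → IsRingMonomorphism GF3-rawRing (Ring.rawRing R) f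

module Chains {a ℓ} (A : Set a) (_≈_ : A → A → Set ℓ) (0# : A) where

  supp : ∀ {n} → (Fin n → A) → Pred (Fin n) ℓ
  supp c e = ¬ (c e ≈ 0#)

  NonZero : ∀ {n} → (Fin n → A) → Set ℓ
  NonZero c = ¬ (∀ e → c e ≈ 0#)

  Elementary : ∀ {n k} → Pred (Fin n → A) k → (Fin n → A) → Set (a ⊔ ℓ ⊔ k)
  Elementary C c =
    C c × NonZero c ×
    ¬ (Σ _ λ d → C d × NonZero d × (supp d ⊆ supp c) × ¬ (supp c ⊆ supp d))

  -- D ⊆ E (given as a characteristic vector) is a cocircuit of M(C),
  -- i.e. the support of an elementary chain of C
  IsCocircuit : ∀ {n k} → Pred (Fin n → A) k → (Fin n → Bool) → Set (a ⊔ ℓ ⊔ k)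
  IsCocircuit C D = Σ _ λ c → Elementary C c × (∀ e → (D e ≡ true) ⇔ supp c e)

module _ {c ℓ} (R : Ring c ℓ) where
  open Ring R

  IsUnit : Carrier → Set (c ⊔ ℓ)
  IsUnit g = Σ Carrier λ h → (g * h ≈ 1#) × (h * g ≈ 1#)

  record IsSkewPartialField {g} (G : Pred Carrier g) : Set (c ⊔ ℓ ⊔ g) where
    field
      respects : ∀ {x y} → x ≈ y → G x → G y
      units    : ∀ {x} → G x → IsUnit x
      one      : G 1#
      mul      : ∀ {x y} → G x → G y → G (x * y)
      inv      : ∀ {x h} → G x → x * h ≈ 1# → h * x ≈ 1# → G h
      minusOne : G (- 1#)

  record IsChainGroup {n k} (C : Pred (Fin n → Carrier) k) : Set (c ⊔ ℓ ⊔ k) where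
    field
      respects : ∀ {x y} → (∀ e → x e ≈ y e) → C x → C y
      zero∈    : C (λ _ → 0#)
      add      : ∀ {x y} → C x → C y → C (λ e → x e + y e)
      scale    : ∀ r {x} → C x → C (λ e → r * x e)

  open Chains Carrier _≈_ 0# public

  Primitive : ∀ {n g} → Pred Carrier g → (Fin n → Carrier) → Set (ℓ ⊔ g)
  Primitive G x = ∀ e → G (x e) ⊎ (x e ≈ 0#)

  record IsPChainGroup {n g k} (G : Pred Carrier g) (C : Pred (Fin n → Carrier) k)
         : Set (c ⊔ ℓ ⊔ g ⊔ k) where
    field
      chainGroup : IsChainGroup C
      elementary-primitive : ∀ x → Elementary C x →
                   Σ Carrier λ r → Σ (Fin n → Carrier) λ x′ →
                     C x′ × Primitive G x′ × (∀ e → x e ≈ r * x′ e)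

-- columns 1..9 of the matrix in the paper (rows 1..3)
R9-matrix : Fin 3 → Fin 9 → GF3
R9-matrix i e = row i e
  where
  0' 1' 2' : GF3
  0' = zero
  1' = suc zero
  2' = suc (suc zero)
  lk : GF3 → GF3 → GF3 → GF3 → GF3 → GF3 → GF3 → GF3 → GF3 → Fin 9 → GF3
  lk a₁ a₂ a₃ a₄ a₅ a₆ a₇ a₈ a₉ zero = a₁
  lk a₁ a₂ a₃ a₄ a₅ a₆ a₇ a₈ a₉ (suc zero) = a₂
  lk a₁ a₂ a₃ a₄ a₅ a₆ a₇ a₈ a₉ (suc (suc zero)) = a₃
  lk a₁ a₂ a₃ a₄ a₅ a₆ a₇ a₈ a₉ (suc (suc (suc zero))) = a₄
  lk a₁ a₂ a₃ a₄ a₅ a₆ a₇ a₈ a₉ (suc (suc (suc (suc zero)))) = a₅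
  lk a₁ a₂ a₃ a₄ a₅ a₆ a₇ a₈ a₉ (suc (suc (suc (suc (suc zero))))) = a₆
  lk a₁ a₂ a₃ a₄ a₅ a₆ a₇ a₈ a₉ (suc (suc (suc (suc (suc (suc zero)))))) = a₇
  lk a₁ a₂ a₃ a₄ a₅ a₆ a₇ a₈ a₉ (suc (suc (suc (suc (suc (suc (suc zero))))))) = a₈
  lk a₁ a₂ a₃ a₄ a₅ a₆ a₇ a₈ a₉ (suc (suc (suc (suc (suc (suc (suc (suc zero)))))))) = a₉
  row : Fin 3 → Fin 9 → GF3
  row zero = lk 1' 0' 0' 1' 1' 1' 0' 0' 1'
  row (suc zero) = lk 0' 1' 0' 1' 1' 2' 1' 1' 0'
  row (suc (suc zero)) = lk 0' 0' 1' 1' 0' 0' 1' 2' 1'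

R9-rowSpace : Pred (Fin 9 → GF3) Level.zero
R9-rowSpace v = Σ (Fin 3 → GF3) λ y → ∀ e →
  v e ≡ ((y zero *₃ R9-matrix zero e) +₃ (y (suc zero) *₃ R9-matrix (suc zero) e))
          +₃ (y (suc (suc zero)) *₃ R9-matrix (suc (suc zero)) e)

-- cocircuits of R9 = column matroid of the matrix = supports of elementary
-- vectors of its row space
R9-Cocircuit : (Fin 9 → Bool) → Set
R9-Cocircuit = Chains.IsCocircuit GF3 _≡_ zero R9-rowSpace

-- M is representable over (R , G'): there is an (R,G')-chain group C on Fin 9
-- with M(C) = R9, i.e. the cocircuits of M(C) are exactly those of R9
R9-RepresentableOver : ∀ {c ℓ g} (R : Ring c ℓ) (G : Pred (Ring.Carrier R) g) (k : Level)
                       → Set (c ⊔ ℓ ⊔ g ⊔ lsuc k)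
R9-RepresentableOver R G k =
  Σ (Pred (Fin 9 → Ring.Carrier R) k) λ C →
    IsPChainGroup R G C × (∀ D → IsCocircuit R C D ⇔ R9-Cocircuit D)

-- Scale the elementary chains of C supported like the rows of the GF(3) matrix so that they take
-- the value 1 on the elements 0, 1, 2 respectively. The basis {0, 1, 2} of R9 meets every cocircuit,
-- and a nonzero chain contains the support of an elementary one, so a chain vanishing on the basis
-- vanishes: every chain is the left combination of the three scaled rows with its own entries on the
-- basis as coefficients. The zeros of the scaled elementary chains supported on six further
-- cocircuits thus become fifteen equations between entries of the rows, which force a + a + a = 0
-- for a unit a. Hence 1 + 1 + 1 = 0 in the nontrivial ring R, and {0, 1, -1} is a copy of GF(3).
module Submission where

open import Defs hiding (supp; NonZero; Elementary; IsCocircuit)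
open import Level using (Level; _⊔_)
open import Algebra.Bundles using (Ring)
open import Data.Bool using (Bool; true; false)
import Data.Bool as Bool
open import Data.Empty using (⊥-elim)
open import Data.Fin using (Fin; zero; suc; toℕ; #_; _≟_)
open import Data.Fin.Properties using (all?)
open import Data.Fin.Subset using (_∈_; _⊂_; ⊤; _-_)
open import Data.Fin.Subset.Properties using (∈⊤; x∈p∧x≢y⇒x∈p-y; x∈p⇒p-x⊂p)
open import Data.Fin.Subset.Induction using (⊂-wellFounded)
open import Data.Nat using (_<_; z<s; s<s)
open import Data.Product using (Σ; ∃; _×_; _,_; proj₁; proj₂)
open import Data.Sum using (_⊎_; inj₁; inj₂)
open import Data.Vec.Functional using ([]; _∷_)
open import Function.Base using (_∘_)
open import Function.Bundles using (_⇔_; mk⇔; Equivalence)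
open import Induction.WellFounded using (Acc; acc)
open import Relation.Nullary using (¬_; Dec; yes; no; ¬?)
open import Relation.Nullary.Decidable
  using (_×-dec_; _→-dec_; _⊎-dec_; map′; True; toWitness; isNo; ¬¬-excluded-middle; decidable-stable)
open import Relation.Unary using (Pred; _⊆_)
open import Relation.Binary.PropositionalEquality as ≡ using (_≡_)

pattern 𝟙 = suc zero
pattern 𝟚 = suc (suc zero)

isNo⇔¬ : ∀ {p} {P : Set p} (P? : Dec P) → (isNo P? ≡ true) ⇔ (¬ P)
isNo⇔¬ (yes p) = mk⇔ (λ ()) (λ ¬p → ⊥-elim (¬p p))
isNo⇔¬ (no ¬p) = mk⇔ (λ _ → ¬p) (λ _ → ≡.refl)

module UnitArithmetic {c ℓ} (R : Ring c ℓ) where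
  open Ring R
  open import Algebra.Properties.Ring R using (+-inverseʳ-unique)
  open import Relation.Binary.Reasoning.Setoid setoid

  *-cancelʳ-unit : ∀ {u x y} → IsUnit R u → x * u ≈ y * u → x ≈ y
  *-cancelʳ-unit {u} {x} {y} (u⁻¹ , uu⁻¹≈1 , _) xu≈yu = begin
    x              ≈⟨ *-identityʳ x ⟨
    x * 1#         ≈⟨ *-congˡ uu⁻¹≈1 ⟨
    x * (u * u⁻¹)  ≈⟨ *-assoc x u u⁻¹ ⟨
    (x * u) * u⁻¹  ≈⟨ *-congʳ xu≈yu ⟩
    (y * u) * u⁻¹  ≈⟨ *-assoc y u u⁻¹ ⟩
    y * (u * u⁻¹)  ≈⟨ *-congˡ uu⁻¹≈1 ⟩
    y * 1#         ≈⟨ *-identityʳ y ⟩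
    y              ∎

  *-preserves-unit : ∀ {u v} → IsUnit R u → IsUnit R v → IsUnit R (u * v)
  *-preserves-unit {u} {v} (u⁻¹ , uu⁻¹≈1 , u⁻¹u≈1) (v⁻¹ , vv⁻¹≈1 , v⁻¹v≈1) =
    v⁻¹ * u⁻¹ , inverse u v u⁻¹ v⁻¹ vv⁻¹≈1 uu⁻¹≈1 , inverse v⁻¹ u⁻¹ v u u⁻¹u≈1 v⁻¹v≈1
    where
    inverse : ∀ p q p′ q′ → q * q′ ≈ 1# → p * p′ ≈ 1# → (p * q) * (q′ * p′) ≈ 1#
    inverse p q p′ q′ qq′≈1 pp′≈1 = begin
      (p * q) * (q′ * p′)  ≈⟨ *-assoc p q _ ⟩
      p * (q * (q′ * p′))  ≈⟨ *-congˡ (*-assoc q q′ p′) ⟨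
      p * ((q * q′) * p′)  ≈⟨ *-congˡ (*-congʳ qq′≈1) ⟩
      p * (1# * p′)        ≈⟨ *-congˡ (*-identityˡ p′) ⟩
      p * p′               ≈⟨ pp′≈1 ⟩
      1#                   ∎

  *-unit≈0 : ∀ {u x} → IsUnit R u → x * u ≈ 0# → x ≈ 0#
  *-unit≈0 {u} u-unit xu≈0 = *-cancelʳ-unit u-unit (trans xu≈0 (sym (zeroˡ u)))

  coefficient-unique : ∀ {u x y z} → IsUnit R u → x + y * u ≈ 0# → x + z * u ≈ 0# → y ≈ z
  coefficient-unique u-unit x+yu≈0 x+zu≈0 =
    *-cancelʳ-unit u-unit (trans (+-inverseʳ-unique _ _ x+yu≈0) (sym (+-inverseʳ-unique _ _ x+zu≈0)))

  1≈0⇒≈0 : 1# ≈ 0# → ∀ x → x ≈ 0#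
  1≈0⇒≈0 1≈0 x = trans (sym (*-identityˡ x)) (trans (*-congʳ 1≈0) (zeroˡ x))

module _ {c ℓ} (R : Ring c ℓ) where
  open Ring R hiding (zero)
  open import Algebra.Properties.Ring R

  characteristic-3⇒ContainsGF3 : (1# + 1#) + 1# ≈ 0# → ¬ 1# ≈ 0# → ContainsGF3 R
  characteristic-3⇒ContainsGF3 3≈0 1≉0 = embed , record
    { isRingHomomorphism = record
      { isSemiringHomomorphism = record
        { isNearSemiringHomomorphism = record
          { +-isMonoidHomomorphism = record
            { isMagmaHomomorphism = record
              { isRelHomomorphism = record { cong = λ { ≡.refl → refl } }
              ; homo = +-homo }
            ; ε-homo = refl }
          ; *-homo = *-homo }
        ; 1#-homo = refl }
      ; -‿homo = -‿homo }
    ; injective = injective }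
    where
    embed : GF3 → Carrier
    embed zero             = 0#
    embed (suc zero)       = 1#
    embed (suc (suc zero)) = - 1#

    2≈-1 : 1# + 1# ≈ - 1#
    2≈-1 = +-inverseˡ-unique (1# + 1#) 1# 3≈0

    -1-1≈1 : - 1# + - 1# ≈ 1#
    -1-1≈1 = trans (-‿+-comm 1# 1#) (trans (-‿cong 2≈-1) (-‿involutive 1#))

    -1≉0 : ¬ - 1# ≈ 0#
    -1≉0 -1≈0 = 1≉0 (trans (sym (-‿involutive 1#)) (trans (-‿cong -1≈0) -0#≈0#))

    1≉-1 : ¬ 1# ≈ - 1#
    1≉-1 1≈-1 = -1≉0 (trans (sym 2≈-1) (trans (+-congˡ 1≈-1) (-‿inverseʳ 1#)))

    +-homo : ∀ x y → embed (x +₃ y) ≈ embed x + embed y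
    +-homo zero             y                = sym (+-identityˡ _)
    +-homo (suc zero)       zero             = sym (+-identityʳ _)
    +-homo (suc (suc zero)) zero             = sym (+-identityʳ _)
    +-homo (suc zero)       (suc zero)       = sym 2≈-1
    +-homo (suc zero)       (suc (suc zero)) = sym (-‿inverseʳ 1#)
    +-homo (suc (suc zero)) (suc zero)       = sym (-‿inverseˡ 1#)
    +-homo (suc (suc zero)) (suc (suc zero)) = sym -1-1≈1

    *-homo : ∀ x y → embed (x *₃ y) ≈ embed x * embed y
    *-homo zero             y                = sym (zeroˡ _)
    *-homo (suc zero)       y                = sym (*-identityˡ _)
    *-homo (suc (suc zero)) zero             = sym (zeroʳ _)
    *-homo (suc (suc zero)) (suc zero)       = sym (*-identityʳ _)
    *-homo (suc (suc zero)) (suc (suc zero)) = sym (trans (-1*x≈-x (- 1#)) (-‿involutive 1#))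

    -‿homo : ∀ x → embed (-₃ x) ≈ - embed x
    -‿homo zero             = sym -0#≈0#
    -‿homo (suc zero)       = refl
    -‿homo (suc (suc zero)) = sym (-‿involutive 1#)

    injective : ∀ {x y} → embed x ≈ embed y → x ≡ y
    injective {zero}           {zero}           _   = ≡.refl
    injective {zero}           {suc zero}       0≈1 = ⊥-elim (1≉0 (sym 0≈1))
    injective {zero}           {suc (suc zero)} 0≈-1 = ⊥-elim (-1≉0 (sym 0≈-1))
    injective {suc zero}       {zero}           1≈0 = ⊥-elim (1≉0 1≈0)
    injective {suc zero}       {suc zero}       _   = ≡.refl
    injective {suc zero}       {suc (suc zero)} 1≈-1 = ⊥-elim (1≉-1 1≈-1)
    injective {suc (suc zero)} {zero}           -1≈0 = ⊥-elim (-1≉0 -1≈0)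
    injective {suc (suc zero)} {suc zero}       -1≈1 = ⊥-elim (1≉-1 (sym -1≈1))
    injective {suc (suc zero)} {suc (suc zero)} _   = ≡.refl

module SupportDescent {a ℓ} {A : Set a} (_≈_ : A → A → Set ℓ) (0# : A) where
  open Chains A _≈_ 0#

  -- Equality of entries is not decidable, so the descent through strictly smaller supports is
  -- carried out under a double negation, bounding each support by a decidable subset.
  elementary-below : ∀ {n k} {C : Pred (Fin n → A) k} {w} → C w → NonZero w →
                     ¬ ¬ (∃ λ x → Elementary C x × supp x ⊆ supp w)
  elementary-below {C = C} Cw nzw = descend ⊤ (⊂-wellFounded ⊤) Cw nzw (λ _ → ∈⊤)
    where
    descend : ∀ s → Acc _⊂_ s → ∀ {w} → C w → NonZero w → supp w ⊆ (_∈ s) →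
              ¬ ¬ (∃ λ x → Elementary C x × supp x ⊆ supp w)
    descend s (acc below-s) {w} Cw nzw w⊆s no-x = ¬¬-excluded-middle λ where
      (no w-minimal) → no-x (w , (Cw , nzw , w-minimal) , λ sw → sw)
      (yes (d , Cd , nzd , d⊆w , w⊈d)) → w⊈d λ {e₀} swe₀ de₀≈0 →
        descend (s - e₀) (below-s (x∈p⇒p-x⊂p (w⊆s swe₀))) Cd nzd
          (λ {e} sde → x∈p∧x≢y⇒x∈p-y (w⊆s (d⊆w sde)) λ { ≡.refl → sde de₀≈0 })
          (λ (x , elx , x⊆d) → no-x (x , elx , d⊆w ∘ x⊆d))

module ChainGroup {c ℓ g k} (R : Ring c ℓ) {G : Pred (Ring.Carrier R) g} (spf : IsSkewPartialField R G)
                  {n} {C : Pred (Fin n → Ring.Carrier R) k} (pcg : IsPChainGroup R G C) where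
  open Ring R
  open Chains Carrier _≈_ 0#
  open UnitArithmetic R
  open IsSkewPartialField spf using (units; mul; inv)
  open IsPChainGroup pcg using (chainGroup; elementary-primitive)
  open IsChainGroup chainGroup using (add; scale)
  open SupportDescent _≈_ 0# using (elementary-below)

  module Rescaled {x x′ : Fin n → Carrier} {r : Carrier} (nzx : NonZero x) (x′-primitive : Primitive R G x′)
                  (x≈rx′ : ∀ e → x e ≈ r * x′ e) where

    x′≈0⇒x≈0 : ∀ {e} → x′ e ≈ 0# → x e ≈ 0#
    x′≈0⇒x≈0 {e} x′e≈0 = trans (x≈rx′ e) (trans (*-congˡ x′e≈0) (zeroʳ r))

    G⇒supp : ∀ {e} → G (x′ e) → supp x e
    G⇒supp {e} x′e∈G xe≈0 = nzx λ e′ → trans (x≈rx′ e′) (trans (*-congʳ r≈0) (zeroˡ (x′ e′)))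
      where
      r≈0 : r ≈ 0#
      r≈0 = *-unit≈0 (units x′e∈G) (trans (sym (x≈rx′ e)) xe≈0)

    supp⇔ : ∀ e → supp x e ⇔ supp x′ e
    supp⇔ e = mk⇔ (λ sxe x′e≈0 → sxe (x′≈0⇒x≈0 x′e≈0)) from
      where
      from : supp x′ e → supp x e
      from sx′e with x′-primitive e
      ... | inj₁ x′e∈G = G⇒supp x′e∈G
      ... | inj₂ x′e≈0 = ⊥-elim (sx′e x′e≈0)

    zero? : ∀ e → Dec (x e ≈ 0#)
    zero? e with x′-primitive e
    ... | inj₁ x′e∈G = no (G⇒supp x′e∈G)
    ... | inj₂ x′e≈0 = yes (x′≈0⇒x≈0 x′e≈0)

  elementary-zero? : ∀ {x} → Elementary C x → ∀ e → Dec (x e ≈ 0#)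
  elementary-zero? {x} elx@(_ , nzx , _) with elementary-primitive x elx
  ... | _ , _ , _ , x′-primitive , x≈rx′ = Rescaled.zero? nzx x′-primitive x≈rx′

  -- Apart from membership in C, elementarity is a negative statement about supports.
  elementary-respects-supp : ∀ {x y} → Elementary C x → C y → ¬ ¬ (∀ e → supp x e ⇔ supp y e) →
                             Elementary C y
  elementary-respects-supp {x} {y} elx@(_ , nzx , x-minimal) Cy same-supp = Cy , nzy , y-minimal
    where
    nzy : NonZero y
    nzy y≈0 = same-supp λ x~y → nzx λ e →
      decidable-stable (elementary-zero? elx e) λ sxe → Equivalence.to (x~y e) sxe (y≈0 e)
    y-minimal : ¬ (Σ _ λ d → C d × NonZero d × supp d ⊆ supp y × ¬ (supp y ⊆ supp d))
    y-minimal (d , Cd , nzd , d⊆y , y⊈d) = same-supp λ x~y → x-minimal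
      ( d , Cd , nzd , (λ {e} sde → Equivalence.from (x~y e) (d⊆y sde))
      , λ x⊆d → y⊈d λ {e} sye → x⊆d (Equivalence.from (x~y e) sye))

  cocircuit-of-elementary : ∀ {x} (elx : Elementary C x) → IsCocircuit C (λ e → isNo (elementary-zero? elx e))
  cocircuit-of-elementary {x} elx = x , elx , λ e → isNo⇔¬ (elementary-zero? elx e)

  record CocircuitChain (D : Fin n → Bool) : Set (c ⊔ ℓ ⊔ g ⊔ k) where
    field
      chain       : Fin n → Carrier
      elementary  : Elementary C chain
      on-support  : ∀ {e} → D e ≡ true → G (chain e)
      off-support : ∀ {e} → D e ≡ false → chain e ≈ 0#

  cocircuitChain : ∀ {D} → IsCocircuit C D → CocircuitChain D
  cocircuitChain {D} (x , elx@(_ , nzx , _) , D⇔supp) with elementary-primitive x elx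
  ... | _ , x′ , x′∈C , x′-primitive , x≈rx′ = record
    { chain       = x′
    ; elementary  = elementary-respects-supp elx x′∈C λ k → k supp⇔
    ; on-support  = on-support
    ; off-support = off-support
    }
    where
    open Rescaled nzx x′-primitive x≈rx′
    on-support : ∀ {e} → D e ≡ true → G (x′ e)
    on-support {e} De with x′-primitive e
    ... | inj₁ x′e∈G = x′e∈G
    ... | inj₂ x′e≈0 = ⊥-elim (Equivalence.to (D⇔supp e) De (x′≈0⇒x≈0 x′e≈0))
    off-support : ∀ {e} → D e ≡ false → x′ e ≈ 0#
    off-support {e} ¬De with x′-primitive e
    ... | inj₁ x′e∈G with () ← ≡.trans (≡.sym (Equivalence.from (D⇔supp e) (G⇒supp x′e∈G))) ¬De
    ... | inj₂ x′e≈0 = x′e≈0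

  record NormalisedChain (D : Fin n → Bool) (j : Fin n) : Set (c ⊔ ℓ ⊔ g ⊔ k) where
    field
      chain       : Fin n → Carrier
      ∈C          : C chain
      normalised  : chain j ≈ 1#
      on-support  : ∀ {e} → D e ≡ true → G (chain e)
      off-support : ∀ {e} → D e ≡ false → chain e ≈ 0#

  normalise : ∀ {D j} → CocircuitChain D → D j ≡ true → NormalisedChain D j
  normalise X Dj with units (CocircuitChain.on-support X Dj)
  ... | h , xh≈1 , hx≈1 = record
    { chain       = λ e → h * chain e
    ; ∈C          = scale h (proj₁ elementary)
    ; normalised  = hx≈1
    ; on-support  = λ De → mul (inv (on-support Dj) xh≈1 hx≈1) (on-support De)
    ; off-support = λ ¬De → trans (*-congˡ (off-support ¬De)) (zeroʳ h)
    }
    where open CocircuitChain X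

  module NormalisedChainProperties {D j} (X : NormalisedChain D j) where
    open NormalisedChain X public

    normalised· : ∀ x → chain j * x ≈ x
    normalised· x = trans (*-congʳ normalised) (*-identityˡ x)

    off· : ∀ {e} → D e ≡ false → ∀ x → chain e * x ≈ 0#
    off· ¬De x = trans (*-congʳ (off-support ¬De)) (zeroˡ x)

    ·normalised : ∀ x → x * chain j ≈ x
    ·normalised x = trans (*-congˡ normalised) (*-identityʳ x)

    ·off : ∀ {e} → D e ≡ false → ∀ x → x * chain e ≈ 0#
    ·off ¬De x = trans (*-congˡ (off-support ¬De)) (zeroʳ x)

  -- Adding a chain that is not nonzero to an elementary chain t yields an elementary chain,
  -- whose entries are decidable; this recovers an honest zero where t vanishes.
  ¬NonZero⇒≈0 : ∀ {t w e} → Elementary C t → t e ≈ 0# → C w → ¬ NonZero w → w e ≈ 0#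
  ¬NonZero⇒≈0 {t} {w} {e} elt te≈0 Cw ¬nzw with elementary-zero? elw+t e
    where
    w≈0⇒w+t≈t : ∀ {e} → w e ≈ 0# → w e + t e ≈ t e
    w≈0⇒w+t≈t {e} we≈0 = trans (+-congʳ we≈0) (+-identityˡ (t e))
    elw+t : Elementary C (λ e → w e + t e)
    elw+t = elementary-respects-supp elt (add Cw (proj₁ elt)) λ k → ¬nzw λ w≈0 → k λ e →
      mk⇔ (λ ste w+te≈0 → ste (trans (sym (w≈0⇒w+t≈t (w≈0 e))) w+te≈0))
          (λ sw+te te≈0 → sw+te (trans (w≈0⇒w+t≈t (w≈0 e)) te≈0))
  ... | yes w+te≈0 = trans (sym (trans (+-congˡ te≈0) (+-identityʳ (w e)))) w+te≈0
  ... | no w+te≉0 = ⊥-elim (¬nzw λ w≈0 → w+te≉0 (trans (+-congʳ (w≈0 e)) (trans (+-identityˡ (t e)) te≈0)))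

  Spanning : ∀ {b} → Pred (Fin n) b → Set _
  Spanning B = ∀ {x} → Elementary C x → ∃ λ e → B e × supp x e

  zero-on-spanning⇒≈0 : ∀ {b} {B : Pred (Fin n) b} → Spanning B →
                        (∀ e → ∃ λ t → Elementary C t × t e ≈ 0#) →
                        ∀ {w} → C w → (∀ {e} → B e → w e ≈ 0#) → ∀ e → w e ≈ 0#
  zero-on-spanning⇒≈0 B-spans avoiding {w} Cw w≈0-on-B e with avoiding e
  ... | t , elt , te≈0 = ¬NonZero⇒≈0 elt te≈0 Cw λ nzw → elementary-below Cw nzw
    λ (x , elx , x⊆w) → let (e′ , Be′ , sxe′) = B-spans elx in x⊆w sxe′ (w≈0-on-B Be′)

-- Entries of the three normalised rows are named after their (0-based) column, row 0 by a, row 1 by b,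
-- row 2 by c; the chains A, …, F have coefficient vectors (0,1,2), (1,0,2), (1,2,0), (1,1,1),
-- (1,1,2), (1,2,2), normalised to have first nonzero coefficient 1, and Xᵢ is the coefficient of
-- row i in X. The field Xj records that X vanishes on column j.
record ReidRelations {c ℓ} (R : Ring c ℓ) : Set (c ⊔ ℓ) where
  open Ring R
  field
    a₃ a₄ a₅ a₈ b₃ b₄ b₅ b₆ b₇ c₃ c₆ c₇ c₈ A₂ B₂ C₁ D₁ D₂ E₁ E₂ F₁ F₂ : Carrier
    a₃-unit : IsUnit R a₃
    b₄-unit : IsUnit R b₄
    b₅-unit : IsUnit R b₅
    c₃-unit : IsUnit R c₃
    c₆-unit : IsUnit R c₆
    c₇-unit : IsUnit R c₇
    c₈-unit : IsUnit R c₈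
    A₂-unit : IsUnit R A₂
    A3 : b₃ + A₂ * c₃ ≈ 0#
    A6 : b₆ + A₂ * c₆ ≈ 0#
    B3 : a₃ + B₂ * c₃ ≈ 0#
    B8 : a₈ + B₂ * c₈ ≈ 0#
    C3 : a₃ + C₁ * b₃ ≈ 0#
    C4 : a₄ + C₁ * b₄ ≈ 0#
    D3 : (a₃ + D₁ * b₃) + D₂ * c₃ ≈ 0#
    D5 : a₅ + D₁ * b₅ ≈ 0#
    D7 : D₁ * b₇ + D₂ * c₇ ≈ 0#
    E5 : a₅ + E₁ * b₅ ≈ 0#
    E6 : E₁ * b₆ + E₂ * c₆ ≈ 0#
    E8 : a₈ + E₂ * c₈ ≈ 0#
    F4 : a₄ + F₁ * b₄ ≈ 0#
    F7 : F₁ * b₇ + F₂ * c₇ ≈ 0#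
    F8 : a₈ + F₂ * c₈ ≈ 0#

module _ {c ℓ} {R : Ring c ℓ} (rel : ReidRelations R) where
  open Ring R
  open ReidRelations rel
  open UnitArithmetic R
  open import Algebra.Properties.Ring R
  open import Relation.Binary.Reasoning.Setoid setoid

  reidRelations⇒3≈0 : (1# + 1#) + 1# ≈ 0#
  reidRelations⇒3≈0 = *-cancelʳ-unit a₃-unit (begin
    ((1# + 1#) + 1#) * a₃  ≈⟨ distribʳ a₃ _ _ ⟩
    (1# + 1#) * a₃ + 1# * a₃  ≈⟨ +-cong (distribʳ a₃ _ _) (*-identityˡ a₃) ⟩
    (1# * a₃ + 1# * a₃) + a₃  ≈⟨ +-congʳ (+-cong (*-identityˡ a₃) (*-identityˡ a₃)) ⟩
    (a₃ + a₃) + a₃            ≈⟨ +-cong (+-congˡ D₁b₃≈a₃) D₂c₃≈a₃ ⟨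
    (a₃ + D₁ * b₃) + D₂ * c₃  ≈⟨ D3 ⟩
    0#                        ≈⟨ zeroˡ a₃ ⟨
    0# * a₃                   ∎)
    where
    E₁≈D₁ : E₁ ≈ D₁
    E₁≈D₁ = coefficient-unique b₅-unit E5 D5
    F₂≈E₂ : F₂ ≈ E₂
    F₂≈E₂ = coefficient-unique c₈-unit F8 E8
    E₂≈B₂ : E₂ ≈ B₂
    E₂≈B₂ = coefficient-unique c₈-unit E8 B8
    F₁≈C₁ : F₁ ≈ C₁
    F₁≈C₁ = coefficient-unique b₄-unit F4 C4
    b₃≈ : b₃ ≈ - (A₂ * c₃)
    b₃≈ = +-inverseˡ-unique b₃ _ A3
    B₂c₃≈ : B₂ * c₃ ≈ - a₃
    B₂c₃≈ = +-inverseʳ-unique a₃ _ B3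
    E₂≈E₁A₂ : E₂ ≈ E₁ * A₂
    E₂≈E₁A₂ = *-cancelʳ-unit c₆-unit (begin
      E₂ * c₆               ≈⟨ +-inverseʳ-unique _ _ E6 ⟩
      - (E₁ * b₆)           ≈⟨ -‿cong (*-congˡ (+-inverseˡ-unique b₆ _ A6)) ⟩
      - (E₁ * - (A₂ * c₆))  ≈⟨ -‿cong (-‿distribʳ-* E₁ _) ⟨
      - - (E₁ * (A₂ * c₆))  ≈⟨ -‿involutive _ ⟩
      E₁ * (A₂ * c₆)        ≈⟨ *-assoc E₁ A₂ c₆ ⟨
      (E₁ * A₂) * c₆        ∎)
    E₁A₂c₃≈ : E₁ * (A₂ * c₃) ≈ - a₃
    E₁A₂c₃≈ = begin
      E₁ * (A₂ * c₃)  ≈⟨ *-assoc E₁ A₂ c₃ ⟨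
      (E₁ * A₂) * c₃  ≈⟨ *-congʳ E₂≈E₁A₂ ⟨
      E₂ * c₃         ≈⟨ *-congʳ E₂≈B₂ ⟩
      B₂ * c₃         ≈⟨ B₂c₃≈ ⟩
      - a₃            ∎
    F₁≈-E₁ : F₁ ≈ - E₁
    F₁≈-E₁ = *-cancelʳ-unit (*-preserves-unit A₂-unit c₃-unit) (begin
      F₁ * (A₂ * c₃)        ≈⟨ *-congʳ F₁≈C₁ ⟩
      C₁ * (A₂ * c₃)        ≈⟨ -‿involutive _ ⟨
      - - (C₁ * (A₂ * c₃))  ≈⟨ -‿cong (-‿distribʳ-* C₁ _) ⟩
      - (C₁ * - (A₂ * c₃))  ≈⟨ -‿cong (*-congˡ b₃≈) ⟨
      - (C₁ * b₃)           ≈⟨ -‿cong (+-inverseʳ-unique a₃ _ C3) ⟩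
      - - a₃                ≈⟨ -‿cong E₁A₂c₃≈ ⟨
      - (E₁ * (A₂ * c₃))    ≈⟨ -‿distribˡ-* E₁ _ ⟩
      - E₁ * (A₂ * c₃)      ∎)
    D₂≈-E₂ : D₂ ≈ - E₂
    D₂≈-E₂ = *-cancelʳ-unit c₇-unit (begin
      D₂ * c₇         ≈⟨ +-inverseʳ-unique _ _ D7 ⟩
      - (D₁ * b₇)     ≈⟨ -‿cong (*-congʳ E₁≈D₁) ⟨
      - (E₁ * b₇)     ≈⟨ -‿distribˡ-* E₁ b₇ ⟩
      - E₁ * b₇       ≈⟨ *-congʳ F₁≈-E₁ ⟨
      F₁ * b₇         ≈⟨ +-inverseˡ-unique _ _ F7 ⟩
      - (F₂ * c₇)     ≈⟨ -‿cong (*-congʳ F₂≈E₂) ⟩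
      - (E₂ * c₇)     ≈⟨ -‿distribˡ-* E₂ c₇ ⟩
      - E₂ * c₇       ∎)
    D₁b₃≈a₃ : D₁ * b₃ ≈ a₃
    D₁b₃≈a₃ = begin
      D₁ * b₃               ≈⟨ *-congʳ E₁≈D₁ ⟨
      E₁ * b₃               ≈⟨ *-congˡ b₃≈ ⟩
      E₁ * - (A₂ * c₃)      ≈⟨ -‿distribʳ-* E₁ _ ⟨
      - (E₁ * (A₂ * c₃))    ≈⟨ -‿cong E₁A₂c₃≈ ⟩
      - - a₃                ≈⟨ -‿involutive a₃ ⟩
      a₃                    ∎
    D₂c₃≈a₃ : D₂ * c₃ ≈ a₃
    D₂c₃≈a₃ = begin
      D₂ * c₃       ≈⟨ *-congʳ D₂≈-E₂ ⟩
      - E₂ * c₃     ≈⟨ -‿distribˡ-* E₂ c₃ ⟨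
      - (E₂ * c₃)   ≈⟨ -‿cong (*-congʳ E₂≈B₂) ⟩
      - (B₂ * c₃)   ≈⟨ -‿cong B₂c₃≈ ⟩
      - - a₃        ≈⟨ -‿involutive a₃ ⟩
      a₃            ∎

module R9-GF3 where
  open ≡ using (refl; sym; trans; cong₂)
  open Chains GF3 _≡_ zero

  rowVector : (Fin 3 → GF3) → Fin 9 → GF3
  rowVector y e = ((y zero *₃ R9-matrix zero e) +₃ (y 𝟙 *₃ R9-matrix 𝟙 e)) +₃ (y 𝟚 *₃ R9-matrix 𝟚 e)

  support : (Fin 3 → GF3) → Fin 9 → Bool
  support y e = isNo (rowVector y e ≟ zero)

  NonZero? : ∀ {n} (u : Fin n → GF3) → Dec (NonZero u)
  NonZero? u = ¬? (all? λ e → u e ≟ zero)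

  supp⊆? : ∀ {n} (u v : Fin n → GF3) → Dec (supp u ⊆ supp v)
  supp⊆? u v = map′ (λ h {e} → h e) (λ h e → h)
                     (all? λ e → ¬? (u e ≟ zero) →-dec ¬? (v e ≟ zero))

  StrictlyBelow : ∀ {n} → (Fin n → GF3) → (Fin n → GF3) → Set
  StrictlyBelow u v = NonZero u × supp u ⊆ supp v × ¬ (supp v ⊆ supp u)

  StrictlyBelow? : ∀ {n} (u v : Fin n → GF3) → Dec (StrictlyBelow u v)
  StrictlyBelow? u v = NonZero? u ×-dec supp⊆? u v ×-dec ¬? (supp⊆? v u)

  -- Quantifying over the three coefficients rather than over Fin 3 → GF3 makes minimality decidable.
  Minimal : (Fin 3 → GF3) → Set
  Minimal y = NonZero (rowVector y) ×
              (∀ a b c → ¬ StrictlyBelow (rowVector (a ∷ b ∷ c ∷ [])) (rowVector y))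

  Minimal? : ∀ y → Dec (Minimal y)
  Minimal? y = NonZero? (rowVector y) ×-dec
    all? λ a → all? λ b → all? λ c → ¬? (StrictlyBelow? (rowVector (a ∷ b ∷ c ∷ [])) (rowVector y))

  minimal⇒elementary : ∀ {y} → Minimal y → Elementary R9-rowSpace (rowVector y)
  minimal⇒elementary {y} (nz , minimal) = (y , λ _ → refl) , nz , λ where
    (d , (y′ , d≡) , nzd , d⊆ , ⊈d) →
      minimal (y′ zero) (y′ 𝟙) (y′ 𝟚)
        ( (λ y′≡0 → nzd λ e → trans (d≡ e) (y′≡0 e))
        , (λ {e} y′e≢0 → d⊆ λ de≡0 → y′e≢0 (trans (sym (d≡ e)) de≡0))
        , (λ ⊆y′ → ⊈d λ {e} ye≢0 de≡0 → ⊆y′ ye≢0 (trans (sym (d≡ e)) de≡0)))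

  R9-cocircuit : ∀ y → True (Minimal? y) → R9-Cocircuit (support y)
  R9-cocircuit y minimal =
    rowVector y , minimal⇒elementary {y} (toWitness minimal) , λ e → isNo⇔¬ (rowVector y e ≟ zero)

  *₃-identityʳ : ∀ x → x *₃ 𝟙 ≡ x
  *₃-identityʳ zero = refl
  *₃-identityʳ 𝟙    = refl
  *₃-identityʳ 𝟚    = refl

  *₃-zeroʳ : ∀ x → x *₃ zero ≡ zero
  *₃-zeroʳ zero = refl
  *₃-zeroʳ 𝟙    = refl
  *₃-zeroʳ 𝟚    = refl

  +₃-identityʳ : ∀ x → x +₃ zero ≡ x
  +₃-identityʳ zero = refl
  +₃-identityʳ 𝟙    = refl
  +₃-identityʳ 𝟚    = refl

  rowVector-at-0 : ∀ y → rowVector y zero ≡ y zero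
  rowVector-at-0 y = trans (cong₂ _+₃_ (trans (cong₂ _+₃_ (*₃-identityʳ (y zero)) (*₃-zeroʳ (y 𝟙)))
                                              (+₃-identityʳ (y zero)))
                                       (*₃-zeroʳ (y 𝟚)))
                           (+₃-identityʳ (y zero))

  rowVector-at-1 : ∀ y → rowVector y 𝟙 ≡ y 𝟙
  rowVector-at-1 y = trans (cong₂ _+₃_ (cong₂ _+₃_ (*₃-zeroʳ (y zero)) (*₃-identityʳ (y 𝟙))) (*₃-zeroʳ (y 𝟚)))
                           (+₃-identityʳ (y 𝟙))

  rowVector-at-2 : ∀ y → rowVector y 𝟚 ≡ y 𝟚
  rowVector-at-2 y = cong₂ _+₃_ (cong₂ _+₃_ (*₃-zeroʳ (y zero)) (*₃-zeroʳ (y 𝟙))) (*₃-identityʳ (y 𝟚))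

  rowVector-zero : ∀ y → y zero ≡ zero → y 𝟙 ≡ zero → y 𝟚 ≡ zero → ∀ e → rowVector y e ≡ zero
  rowVector-zero y y₀≡0 y₁≡0 y₂≡0 e rewrite y₀≡0 | y₁≡0 | y₂≡0 = refl

  R9-cocircuit-meets-basis : ∀ {D} → R9-Cocircuit D → ∃ λ e → toℕ e < 3 × D e ≡ true
  R9-cocircuit-meets-basis (c , ((y , c≡) , nzc , _) , D⇔supp)
    with c zero ≟ zero | c 𝟙 ≟ zero | c 𝟚 ≟ zero
  ... | no c₀≢0 | _ | _ = zero , z<s , Equivalence.from (D⇔supp zero) c₀≢0
  ... | yes _ | no c₁≢0 | _ = 𝟙 , s<s z<s , Equivalence.from (D⇔supp 𝟙) c₁≢0
  ... | yes _ | yes _ | no c₂≢0 = 𝟚 , s<s (s<s z<s) , Equivalence.from (D⇔supp 𝟚) c₂≢0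
  ... | yes c₀≡0 | yes c₁≡0 | yes c₂≡0 = ⊥-elim (nzc λ e → trans (c≡ e) (rowVector-zero y
        (trans (sym (rowVector-at-0 y)) (trans (sym (c≡ zero)) c₀≡0))
        (trans (sym (rowVector-at-1 y)) (trans (sym (c≡ 𝟙)) c₁≡0))
        (trans (sym (rowVector-at-2 y)) (trans (sym (c≡ 𝟚)) c₂≡0)) e))

  row₀ row₁ row₂ cocA cocB cocC cocD cocE cocF : Fin 3 → GF3
  row₀ = 𝟙 ∷ zero ∷ zero ∷ []
  row₁ = zero ∷ 𝟙 ∷ zero ∷ []
  row₂ = zero ∷ zero ∷ 𝟙 ∷ []
  cocA = zero ∷ 𝟙 ∷ 𝟚 ∷ []
  cocB = 𝟙 ∷ zero ∷ 𝟚 ∷ []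
  cocC = 𝟙 ∷ 𝟚 ∷ zero ∷ []
  cocD = 𝟙 ∷ 𝟙 ∷ 𝟙 ∷ []
  cocE = 𝟙 ∷ 𝟙 ∷ 𝟚 ∷ []
  cocF = 𝟙 ∷ 𝟚 ∷ 𝟚 ∷ []

  avoided : ∀ e → support row₀ e ≡ false ⊎ support row₁ e ≡ false ⊎
                  support row₂ e ≡ false ⊎ support cocA e ≡ false
  avoided = toWitness {a? = all? λ e → support row₀ e Bool.≟ false ⊎-dec support row₁ e Bool.≟ false
                                      ⊎-dec support row₂ e Bool.≟ false ⊎-dec support cocA e Bool.≟ false} _

module R9Representation {c ℓ g k} (R : Ring c ℓ) {G : Pred (Ring.Carrier R) g} (spf : IsSkewPartialField R G)
                        {C : Pred (Fin 9 → Ring.Carrier R) k} (pcg : IsPChainGroup R G C)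
                        (cocircuits : ∀ D → Defs.IsCocircuit R C D ⇔ R9-Cocircuit D)
                        where
  open Ring R renaming (refl to ≈-refl) hiding (zero)
  open import Algebra.Properties.Ring R using (-1*x≈-x; x∙y⁻¹≈ε⇒x≈y; x≈y⇒x∙y⁻¹≈ε)
  open Chains Carrier _≈_ 0#
  open UnitArithmetic R
  open ChainGroup R spf pcg
  open IsSkewPartialField spf using (units)
  open IsPChainGroup pcg using (chainGroup)
  open IsChainGroup chainGroup using (add; scale)
  open R9-GF3
    using (Minimal?; support; R9-cocircuit; R9-cocircuit-meets-basis; avoided;
           row₀; row₁; row₂; cocA; cocB; cocC; cocD; cocE; cocF)

  cocircuitChainOf : ∀ y → True (Minimal? y) → CocircuitChain (support y)
  cocircuitChainOf y minimal = cocircuitChain (Equivalence.from (cocircuits (support y)) (R9-cocircuit y minimal))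

  module Row₀ = CocircuitChain (cocircuitChainOf row₀ _)
  module Row₁ = CocircuitChain (cocircuitChainOf row₁ _)
  module Row₂ = CocircuitChain (cocircuitChainOf row₂ _)
  module CocA = CocircuitChain (cocircuitChainOf cocA _)
  module ρ₀ = NormalisedChainProperties (normalise {j = zero} (cocircuitChainOf row₀ _) ≡.refl)
  module ρ₁ = NormalisedChainProperties (normalise {j = 𝟙} (cocircuitChainOf row₁ _) ≡.refl)
  module ρ₂ = NormalisedChainProperties (normalise {j = 𝟚} (cocircuitChainOf row₂ _) ≡.refl)
  module A = NormalisedChainProperties (normalise {j = 𝟙} (cocircuitChainOf cocA _) ≡.refl)
  module B = NormalisedChainProperties (normalise {j = zero} (cocircuitChainOf cocB _) ≡.refl)
  module C = NormalisedChainProperties (normalise {j = zero} (cocircuitChainOf cocC _) ≡.refl)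
  module D = NormalisedChainProperties (normalise {j = zero} (cocircuitChainOf cocD _) ≡.refl)
  module E = NormalisedChainProperties (normalise {j = zero} (cocircuitChainOf cocE _) ≡.refl)
  module F = NormalisedChainProperties (normalise {j = zero} (cocircuitChainOf cocF _) ≡.refl)

  basis-spans : Spanning (λ e → toℕ e < 3)
  basis-spans elx with R9-cocircuit-meets-basis (Equivalence.to (cocircuits _) (cocircuit-of-elementary elx))
  ... | e , e<3 , De = e , e<3 , Equivalence.to (isNo⇔¬ (elementary-zero? elx e)) De

  avoiding : ∀ e → ∃ λ t → Elementary C t × t e ≈ 0#
  avoiding e with avoided e
  ... | inj₁ ¬De               = _ , Row₀.elementary , Row₀.off-support ¬De
  ... | inj₂ (inj₁ ¬De)        = _ , Row₁.elementary , Row₁.off-support ¬De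
  ... | inj₂ (inj₂ (inj₁ ¬De)) = _ , Row₂.elementary , Row₂.off-support ¬De
  ... | inj₂ (inj₂ (inj₂ ¬De)) = _ , CocA.elementary , CocA.off-support ¬De

  zero-on-basis⇒≈0 : ∀ {w} → C w → w zero ≈ 0# → w 𝟙 ≈ 0# → w 𝟚 ≈ 0# → ∀ e → w e ≈ 0#
  zero-on-basis⇒≈0 {w} Cw w₀≈0 w₁≈0 w₂≈0 = zero-on-spanning⇒≈0 basis-spans avoiding Cw zero-on-basis
    where
    zero-on-basis : ∀ {e} → toℕ e < 3 → w e ≈ 0#
    zero-on-basis {zero}              _                    = w₀≈0
    zero-on-basis {suc zero}          _                    = w₁≈0
    zero-on-basis {suc (suc zero)}    _                    = w₂≈0
    zero-on-basis {suc (suc (suc _))} (s<s (s<s (s<s ())))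

  combination : (Fin 9 → Carrier) → Fin 9 → Carrier
  combination w e = (w zero * ρ₀.chain e + w 𝟙 * ρ₁.chain e) + w 𝟚 * ρ₂.chain e

  combination-∈C : ∀ w → C (combination w)
  combination-∈C w = add (add (scale (w zero) ρ₀.∈C) (scale (w 𝟙) ρ₁.∈C)) (scale (w 𝟚) ρ₂.∈C)

  expand : ∀ {w e X Y Z} → w zero * ρ₀.chain e ≈ X → w 𝟙 * ρ₁.chain e ≈ Y → w 𝟚 * ρ₂.chain e ≈ Z →
           combination w e ≈ (X + Y) + Z
  expand X≈ Y≈ Z≈ = +-cong (+-cong X≈ Y≈) Z≈

  coordinates : ∀ {w} → C w → ∀ e → w e ≈ combination w e
  coordinates {w} Cw e = x∙y⁻¹≈ε⇒x≈y _ _ (trans (+-congˡ (sym (-1*x≈-x _))) (difference≈0 e))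
    where
    difference : Fin 9 → Carrier
    difference e = w e + - 1# * combination w e
    vanishes : ∀ {e} → combination w e ≈ w e → difference e ≈ 0#
    vanishes eq = trans (+-congˡ (-1*x≈-x _)) (x≈y⇒x∙y⁻¹≈ε (sym eq))
    difference≈0 : ∀ e → difference e ≈ 0#
    difference≈0 = zero-on-basis⇒≈0 (add Cw (scale (- 1#) (combination-∈C w)))
      (vanishes (trans (expand {w = w} (ρ₀.·normalised _) (ρ₁.·off ≡.refl _) (ρ₂.·off ≡.refl _))
                       (trans (+-identityʳ _) (+-identityʳ _))))
      (vanishes (trans (expand {w = w} (ρ₀.·off ≡.refl _) (ρ₁.·normalised _) (ρ₂.·off ≡.refl _))
                       (trans (+-identityʳ _) (+-identityˡ _))))
      (vanishes (trans (expand {w = w} (ρ₀.·off ≡.refl _) (ρ₁.·off ≡.refl _) (ρ₂.·normalised _))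
                       (trans (+-congʳ (+-identityʳ _)) (+-identityˡ _))))

  module _ {w e} (Cw : C w) (we≈0 : w e ≈ 0#) where
    vanishing-column : ∀ {X Y Z} → w zero * ρ₀.chain e ≈ X → w 𝟙 * ρ₁.chain e ≈ Y → w 𝟚 * ρ₂.chain e ≈ Z →
                       (X + Y) + Z ≈ 0#
    vanishing-column X≈ Y≈ Z≈ = trans (sym (expand {w = w} X≈ Y≈ Z≈)) (trans (sym (coordinates Cw e)) we≈0)

    vanishing-column₀ : ∀ {Y Z} → w zero * ρ₀.chain e ≈ 0# → w 𝟙 * ρ₁.chain e ≈ Y → w 𝟚 * ρ₂.chain e ≈ Z →
                        Y + Z ≈ 0#
    vanishing-column₀ X≈0 Y≈ Z≈ = trans (+-congʳ (sym (+-identityˡ _))) (vanishing-column X≈0 Y≈ Z≈)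

    vanishing-column₁ : ∀ {X Z} → w zero * ρ₀.chain e ≈ X → w 𝟙 * ρ₁.chain e ≈ 0# → w 𝟚 * ρ₂.chain e ≈ Z →
                        X + Z ≈ 0#
    vanishing-column₁ X≈ Y≈0 Z≈ = trans (+-congʳ (sym (+-identityʳ _))) (vanishing-column X≈ Y≈0 Z≈)

    vanishing-column₂ : ∀ {X Y} → w zero * ρ₀.chain e ≈ X → w 𝟙 * ρ₁.chain e ≈ Y → w 𝟚 * ρ₂.chain e ≈ 0# →
                        X + Y ≈ 0#
    vanishing-column₂ X≈ Y≈ Z≈0 = trans (sym (+-identityʳ _)) (vanishing-column X≈ Y≈ Z≈0)

  reidRelations : ReidRelations R
  reidRelations = record
    { a₃ = ρ₀.chain (# 3) ; a₄ = ρ₀.chain (# 4) ; a₅ = ρ₀.chain (# 5) ; a₈ = ρ₀.chain (# 8)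
    ; b₃ = ρ₁.chain (# 3) ; b₄ = ρ₁.chain (# 4) ; b₅ = ρ₁.chain (# 5) ; b₆ = ρ₁.chain (# 6) ; b₇ = ρ₁.chain (# 7)
    ; c₃ = ρ₂.chain (# 3) ; c₆ = ρ₂.chain (# 6) ; c₇ = ρ₂.chain (# 7) ; c₈ = ρ₂.chain (# 8)
    ; A₂ = A.chain 𝟚 ; B₂ = B.chain 𝟚 ; C₁ = C.chain 𝟙 ; D₁ = D.chain 𝟙 ; D₂ = D.chain 𝟚
    ; E₁ = E.chain 𝟙 ; E₂ = E.chain 𝟚 ; F₁ = F.chain 𝟙 ; F₂ = F.chain 𝟚
    ; a₃-unit = units (ρ₀.on-support ≡.refl)
    ; b₄-unit = units (ρ₁.on-support ≡.refl)
    ; b₅-unit = units (ρ₁.on-support ≡.refl)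
    ; c₃-unit = units (ρ₂.on-support ≡.refl)
    ; c₆-unit = units (ρ₂.on-support ≡.refl)
    ; c₇-unit = units (ρ₂.on-support ≡.refl)
    ; c₈-unit = units (ρ₂.on-support ≡.refl)
    ; A₂-unit = units (A.on-support ≡.refl)
    ; A3 = vanishing-column₀ A.∈C (A.off-support ≡.refl) (A.off· ≡.refl _) (A.normalised· _) ≈-refl
    ; A6 = vanishing-column₀ A.∈C (A.off-support ≡.refl) (A.off· ≡.refl _) (A.normalised· _) ≈-refl
    ; B3 = vanishing-column₁ B.∈C (B.off-support ≡.refl) (B.normalised· _) (B.off· ≡.refl _) ≈-refl
    ; B8 = vanishing-column₁ B.∈C (B.off-support ≡.refl) (B.normalised· _) (ρ₁.·off ≡.refl _) ≈-refl
    ; C3 = vanishing-column₂ C.∈C (C.off-support ≡.refl) (C.normalised· _) ≈-refl (C.off· ≡.refl _)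
    ; C4 = vanishing-column₂ C.∈C (C.off-support ≡.refl) (C.normalised· _) ≈-refl (C.off· ≡.refl _)
    ; D3 = vanishing-column D.∈C (D.off-support ≡.refl) (D.normalised· _) ≈-refl ≈-refl
    ; D5 = vanishing-column₂ D.∈C (D.off-support ≡.refl) (D.normalised· _) ≈-refl (ρ₂.·off ≡.refl _)
    ; D7 = vanishing-column₀ D.∈C (D.off-support ≡.refl) (ρ₀.·off ≡.refl _) ≈-refl ≈-refl
    ; E5 = vanishing-column₂ E.∈C (E.off-support ≡.refl) (E.normalised· _) ≈-refl (ρ₂.·off ≡.refl _)
    ; E6 = vanishing-column₀ E.∈C (E.off-support ≡.refl) (ρ₀.·off ≡.refl _) ≈-refl ≈-refl
    ; E8 = vanishing-column₁ E.∈C (E.off-support ≡.refl) (E.normalised· _) (ρ₁.·off ≡.refl _) ≈-refl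
    ; F4 = vanishing-column₂ F.∈C (F.off-support ≡.refl) (F.normalised· _) ≈-refl (ρ₂.·off ≡.refl _)
    ; F7 = vanishing-column₀ F.∈C (F.off-support ≡.refl) (ρ₀.·off ≡.refl _) ≈-refl ≈-refl
    ; F8 = vanishing-column₁ F.∈C (F.off-support ≡.refl) (F.normalised· _) (ρ₁.·off ≡.refl _) ≈-refl
    }

  1≉0 : ¬ 1# ≈ 0#
  1≉0 1≈0 = proj₁ (proj₂ Row₀.elementary) λ e → 1≈0⇒≈0 1≈0 _

lemma3p36 : ∀ {c ℓ g} (k : Level) (R : Ring c ℓ) (G : Pred (Ring.Carrier R) g)
            → IsSkewPartialField R G
            → R9-RepresentableOver R G k
            → ContainsGF3 R
lemma3p36 k R G spf (C , pcg , cocircuits) =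
  characteristic-3⇒ContainsGF3 R (reidRelations⇒3≈0 reidRelations) 1≉0
  where open R9Representation R spf pcg cocircuits
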